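{- For any integers $a\geq 1$ and $d\geq 1$, the graph $G(a,d)$ has a spanning tree $T$ with maximum degree $\Delta(T)\leq 3$.
   Context: $S(a,d)$ is the set of all $a$-tuples $(j_1,\ldots,j_a)$ of integers with $1\leq j_1\leq j_2\leq\cdots\leq j_a\leq d$. $G(a,d)$ is the graph with vertex set $S(a,d)$ and an edge between two tuples that differ in a single entry by $\pm 1$. -}

module Defs where

open import Level using (0ℓ)
open import Data.Nat using (ℕ; _+_; _≤_; _<_)
open import Data.Fin as Fin using (Fin)
open import Data.Vec using (Vec; lookup)
open import Data.List using (List; []; _∷_; length; _∷ʳ_)
open import Data.List.Membership.Propositional using (_∈_)
open import Data.List.Relation.Unary.Unique.Propositional using (Unique)
open import Data.List.Relation.Unary.Linked using (Linked)
open import Data.Product using (Σ; ∃; _×_)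
open import Data.Sum using (_⊎_)
open import Relation.Binary.PropositionalEquality using (_≡_; _≢_)
open import Relation.Binary.Core using (Rel)
open import Relation.Binary.Construct.Closure.ReflexiveTransitive using (Star)
open import Relation.Nullary using (¬_)
open import Data.Empty using (⊥)

record Graph (V : Set) : Set₁ where
  field
    vertex : V → Set
    adj    : Rel V 0ℓ
open Graph public

InS : (a d : ℕ) → Vec ℕ a → Set
InS a d v =
  (∀ (i : Fin a) → 1 ≤ lookup v i × lookup v i ≤ d) ×
  (∀ (i j : Fin a) → i Fin.≤ j → lookup v i ≤ lookup v j)

DifferByOne : (a : ℕ) → Vec ℕ a → Vec ℕ a → Set
DifferByOne a u v =
  ∃ λ (i : Fin a) →
    (lookup u i + 1 ≡ lookup v i ⊎ lookup v i + 1 ≡ lookup u i) ×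
    (∀ (k : Fin a) → k ≢ i → lookup u k ≡ lookup v k)

G : (a d : ℕ) → Graph (Vec ℕ a)
G a d = record
  { vertex = InS a d
  ; adj    = λ u v → InS a d u × InS a d v × DifferByOne a u v
  }

module _ {V : Set} where

  IsCycle : Rel V 0ℓ → List V → Set
  IsCycle E cs = 3 ≤ length cs × Unique cs × CycleLinked cs
    where
    CycleLinked : List V → Set
    CycleLinked []       = ⊥   -- excluded anyway by 3 ≤ length cs
    CycleLinked (x ∷ xs) = Linked E ((x ∷ xs) ∷ʳ x)

  Acyclic : Rel V 0ℓ → Set
  Acyclic E = ∀ (cs : List V) → ¬ IsCycle E cs

  record IsSpanningTree (Γ : Graph V) (T : Rel V 0ℓ) : Set where
    field
      subgraph  : ∀ u v → T u v → adj Γ u v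
      symmetric : ∀ u v → T u v → T v u
      connected : ∀ u v → vertex Γ u → vertex Γ v → Star T u v
      acyclic   : Acyclic T

  MaxDegree≤ : (Γ : Graph V) → Rel V 0ℓ → ℕ → Set
  MaxDegree≤ Γ T k =
    ∀ v → vertex Γ v →
      Σ (List V) λ L → length L ≤ k × (∀ w → T v w → w ∈ L)

{-# OPTIONS --safe #-}
-- Root the tree at (1,…,1) and make the parent of any other vertex v the vector
-- obtained by lowering the first entry of v that exceeds 1.  It is a neighbour of
-- v in G(a,d) with smaller entry sum, so following parents reaches the root.  The
-- parent edges contain no cycle: on a cycle, a step down to a child can only be
-- followed by further steps down (a step back up would revisit a vertex, parents
-- being unique), so if some step goes down the sum increases strictly all the
-- way round; otherwise every step goes up and the sum decreases all the way round.
-- Finally v + eⱼ has parent v only when j is the last position of the leading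
-- block of 1s in v or the first position after it, so each vertex has at most
-- two children and hence degree at most 3.
module Submission where

open import Defs
open import Level using (0ℓ)
open import Data.Nat using (ℕ; suc; pred; _+_; _≤_; _<_; _≟_; z≤n; s≤s)
open import Data.Nat.Properties using (≤-refl; ≤-reflexive; ≤-trans; <-trans; <-asym; n≤1+n; +-comm)
open import Data.Nat.Induction using (<-wellFounded)
open import Data.Vec using (Vec; []; _∷_; lookup; replicate; sum)
open import Data.Vec.Properties using (≡-dec)
import Data.Fin as Fin
open import Data.List using ([]; _∷_; _∷ʳ_; [_])
open import Data.List.Properties using (length-++-comm)
open import Data.List.Membership.Propositional using (_∈_)
open import Data.List.Relation.Unary.All as All using ([]; _∷_)
import Data.List.Relation.Unary.All.Properties as All
open import Data.List.Relation.Unary.AllPairs using ([]; _∷_)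
open import Data.List.Relation.Unary.Any using (here; there)
open import Data.List.Relation.Unary.Linked as Linked using (Linked; [-]; _∷_)
open import Data.List.Relation.Unary.Linked.Properties using (Linked⇒AllPairs)
open import Data.List.Relation.Unary.Unique.Propositional using (Unique)
import Data.List.Relation.Unary.Unique.Propositional.Properties as Unique
open import Data.Product using (Σ; ∃; _×_; _,_; proj₁; proj₂)
open import Data.Sum as Sum using (_⊎_; inj₁; inj₂)
open import Data.Empty using (⊥-elim)
open import Data.Unit using (⊤; tt)
open import Function using (_∘_)
open import Induction.WellFounded using (Acc; acc)
open import Relation.Binary.Core using (Rel)
open import Relation.Binary.Definitions using (Transitive)
open import Relation.Binary.PropositionalEquality using (_≡_; _≢_; refl; sym; cong; subst)
open import Relation.Binary.Construct.Closure.ReflexiveTransitive as Star using (Star; ε; _◅_; _◅◅_)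
open import Relation.Nullary using (¬_; yes; no)

module _ {A : Set} where

  Unique-rotate : ∀ {x : A} {xs} → Unique (x ∷ xs) → Unique (xs ∷ʳ x)
  Unique-rotate (x∉xs ∷ u) =
    Unique.++⁺ u ([] ∷ []) λ { (v∈xs , here refl) → All.lookup x∉xs v∈xs refl }

  module _ {R : Rel A 0ℓ} where

    Linked-∷ʳ⁺ : ∀ xs {x y} → Linked R (xs ∷ʳ x) → R x y → Linked R (xs ∷ʳ x ∷ʳ y)
    Linked-∷ʳ⁺ []           _          Rxy = Rxy ∷ [-]
    Linked-∷ʳ⁺ (_ ∷ [])     (Rwx ∷ _)  Rxy = Rwx ∷ Rxy ∷ [-]
    Linked-∷ʳ⁺ (_ ∷ w ∷ ws) (Rvw ∷ Rs) Rxy = Rvw ∷ Linked-∷ʳ⁺ (w ∷ ws) Rs Rxy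

    Linked⇒endpoints : Transitive R → ∀ {x} xs {y} → Linked R (x ∷ xs ∷ʳ y) → R x y
    Linked⇒endpoints trans xs Rs with Linked⇒AllPairs trans Rs
    ... | Rx ∷ _ = proj₂ (All.∷ʳ⁻ Rx)

  IsCycle-rotate : ∀ {E : Rel A 0ℓ} {x} xs → IsCycle E (x ∷ xs) → IsCycle E (xs ∷ʳ x)
  IsCycle-rotate []       c                        = c
  IsCycle-rotate {x = x} (y ∷ ys) (3≤len , u , Exy ∷ Es) =
    subst (3 ≤_) (sym (length-++-comm (y ∷ ys) [ x ])) 3≤len ,
    Unique-rotate u ,
    Linked-∷ʳ⁺ (y ∷ ys) Es Exy

-- x ⇾ y : y is the parent of x.
module ParentForest {V : Set} (_⇾_ : Rel V 0ℓ) (rank : V → ℕ)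
  (⇾-functional : ∀ {x y z} → x ⇾ y → x ⇾ z → y ≡ z)
  (⇾-decreasing : ∀ {x y} → x ⇾ y → rank y < rank x) where

  Edge : Rel V 0ℓ
  Edge u v = u ⇾ v ⊎ v ⇾ u

  Edge-sym : ∀ {u v} → Edge u v → Edge v u
  Edge-sym = Sum.swap

  descent-continues : ∀ {x y z} → x ≢ z → y ⇾ x → Edge y z → z ⇾ y
  descent-continues x≢z y⇾x (inj₁ y⇾z) = ⊥-elim (x≢z (⇾-functional y⇾x y⇾z))
  descent-continues _   _   (inj₂ z⇾y) = z⇾y

  path-descends : ∀ {x y} zs → Unique (x ∷ y ∷ zs) → Linked Edge (x ∷ y ∷ zs) →
                  y ⇾ x → Linked (λ u v → v ⇾ u) (x ∷ y ∷ zs)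
  path-descends []       _                     _                  y⇾x = y⇾x ∷ [-]
  path-descends (z ∷ zs) ((_ ∷ x≢z ∷ _) ∷ u) (_ ∷ Es@(y~z ∷ _)) y⇾x =
    y⇾x ∷ path-descends zs u Es (descent-continues x≢z y⇾x y~z)

  no-cycle-starting-down : ∀ {x y} zs → y ⇾ x → ¬ IsCycle Edge (x ∷ y ∷ zs)
  no-cycle-starting-down []       _   (s≤s (s≤s ()) , _)
  no-cycle-starting-down {x} {y} (z ∷ zs) y⇾x (_ , u@((_ ∷ x≢z ∷ _) ∷ _) , _ ∷ Es@(y~z ∷ _)) =
    <-asym (⇾-decreasing y⇾x) (Linked⇒endpoints <-trans (z ∷ zs) rank-increases)
    where
    rank-increases : Linked (λ u v → rank u < rank v) (y ∷ z ∷ zs ∷ʳ x)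
    rank-increases = Linked.map ⇾-decreasing
      (path-descends (zs ∷ʳ x) (Unique-rotate u) Es (descent-continues x≢z y⇾x y~z))

  no-cycle : ∀ {x} xs → Acc _<_ (rank x) → ¬ IsCycle Edge (x ∷ xs)
  no-cycle []       _        (s≤s () , _)
  no-cycle (y ∷ ys) (acc rs) c@(_ , _ , x~y ∷ _) with x~y
  ... | inj₁ x⇾y = no-cycle (ys ∷ʳ _) (rs (⇾-decreasing x⇾y)) (IsCycle-rotate (y ∷ ys) c)
  ... | inj₂ y⇾x = no-cycle-starting-down ys y⇾x c

  acyclic : Acyclic Edge
  acyclic []       (() , _)
  acyclic (x ∷ xs) = no-cycle xs (<-wellFounded (rank x))

  module _ {P : V → Set} {root : V}
    (root-or-parent : ∀ {v} → P v → v ≡ root ⊎ ∃ λ u → v ⇾ u × P u) where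

    path-to-root : ∀ {v} → Acc _<_ (rank v) → P v → Star Edge v root
    path-to-root (acc rs) Pv with root-or-parent Pv
    ... | inj₁ refl           = ε
    ... | inj₂ (u , v⇾u , Pu) = inj₁ v⇾u ◅ path-to-root (rs (⇾-decreasing v⇾u)) Pu

    connected : ∀ {u v} → P u → P v → Star Edge u v
    connected {u} {v} Pu Pv =
      path-to-root (<-wellFounded (rank u)) Pu ◅◅
      Star.reverse Edge-sym (path-to-root (<-wellFounded (rank v)) Pv)

module _ {n : ℕ} where

  DifferByOne-sym : ∀ {u v} → DifferByOne n u v → DifferByOne n v u
  DifferByOne-sym (i , ±1 , same) = i , Sum.swap ±1 , λ k k≢i → sym (same k k≢i)

  DifferByOne-head : ∀ {x y} {u : Vec ℕ n} →
                     x + 1 ≡ y ⊎ y + 1 ≡ x → DifferByOne (suc n) (x ∷ u) (y ∷ u)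
  DifferByOne-head ±1 = Fin.zero , ±1 , λ
    { Fin.zero    0≢0 → ⊥-elim (0≢0 refl)
    ; (Fin.suc k) _   → refl
    }

  DifferByOne-∷ : ∀ {x} {u v : Vec ℕ n} → DifferByOne n u v → DifferByOne (suc n) (x ∷ u) (x ∷ v)
  DifferByOne-∷ (i , ±1 , same) = Fin.suc i , ±1 , λ
    { Fin.zero    _   → refl
    ; (Fin.suc k) k≢i → same k (k≢i ∘ cong Fin.suc)
    }

Sorted : ∀ {n} → ℕ → ℕ → Vec ℕ n → Set
Sorted lo hi []      = ⊤
Sorted lo hi (x ∷ v) = lo ≤ x × x ≤ hi × Sorted x hi v

module _ {hi : ℕ} where

  Sorted-weaken : ∀ {n lo lo′} {v : Vec ℕ n} → lo′ ≤ lo → Sorted lo hi v → Sorted lo′ hi v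
  Sorted-weaken {v = []}    _      _                = tt
  Sorted-weaken {v = _ ∷ _} lo′≤lo (lo≤x , x≤hi , s) = ≤-trans lo′≤lo lo≤x , x≤hi , s

  Sorted⇒bounded : ∀ {n lo} {v : Vec ℕ n} → Sorted lo hi v → ∀ i → lo ≤ lookup v i × lookup v i ≤ hi
  Sorted⇒bounded {v = _ ∷ _} (lo≤x , x≤hi , _) Fin.zero    = lo≤x , x≤hi
  Sorted⇒bounded {v = _ ∷ _} (lo≤x , _    , s) (Fin.suc i) with Sorted⇒bounded s i
  ... | x≤vᵢ , vᵢ≤hi = ≤-trans lo≤x x≤vᵢ , vᵢ≤hi

  Sorted⇒monotone : ∀ {n lo} {v : Vec ℕ n} → Sorted lo hi v →
                    ∀ i j → i Fin.≤ j → lookup v i ≤ lookup v j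
  Sorted⇒monotone {v = _ ∷ _} _           Fin.zero    Fin.zero    _         = ≤-refl
  Sorted⇒monotone {v = _ ∷ _} (_ , _ , s) Fin.zero    (Fin.suc j) _         = proj₁ (Sorted⇒bounded s j)
  Sorted⇒monotone {v = _ ∷ _} (_ , _ , s) (Fin.suc i) (Fin.suc j) (s≤s i≤j) = Sorted⇒monotone s i j i≤j

  bounded∧monotone⇒Sorted : ∀ {n lo} {v : Vec ℕ n} →
    (∀ i → lo ≤ lookup v i × lookup v i ≤ hi) →
    (∀ i j → i Fin.≤ j → lookup v i ≤ lookup v j) → Sorted lo hi v
  bounded∧monotone⇒Sorted {v = []}    _       _    = tt
  bounded∧monotone⇒Sorted {v = _ ∷ _} bounded mono =
    proj₁ (bounded Fin.zero) , proj₂ (bounded Fin.zero) ,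
    bounded∧monotone⇒Sorted (λ i → mono Fin.zero (Fin.suc i) z≤n , proj₂ (bounded (Fin.suc i)))
                            (λ i j i≤j → mono (Fin.suc i) (Fin.suc j) (s≤s i≤j))

  Sorted⇒InS : ∀ {n} {v : Vec ℕ n} → Sorted 1 hi v → InS n hi v
  Sorted⇒InS s = Sorted⇒bounded s , Sorted⇒monotone s

  InS⇒Sorted : ∀ {n} {v : Vec ℕ n} → InS n hi v → Sorted 1 hi v
  InS⇒Sorted (bounded , mono) = bounded∧monotone⇒Sorted bounded mono

ones : ∀ n → Vec ℕ n
ones n = replicate n 1

parent : ∀ {n} → Vec ℕ n → Vec ℕ n
parent []      = []
parent (1 ∷ v) = 1 ∷ parent v
parent (x ∷ v) = pred x ∷ v

raiseLastOne : ∀ {n} → Vec ℕ n → Vec ℕ n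
raiseLastOne (1 ∷ 1 ∷ v) = 1 ∷ raiseLastOne (1 ∷ v)
raiseLastOne (1 ∷ v)     = 2 ∷ v
raiseLastOne v           = v

raiseFirstNonOne : ∀ {n} → Vec ℕ n → Vec ℕ n
raiseFirstNonOne []      = []
raiseFirstNonOne (1 ∷ v) = 1 ∷ raiseFirstNonOne v
raiseFirstNonOne (x ∷ v) = suc x ∷ v

module _ {hi : ℕ} where

  parent-sorted : ∀ {n} {w : Vec ℕ n} → Sorted 1 hi w → Sorted 1 hi (parent w)
  parent-sorted {w = []}              _                = tt
  parent-sorted {w = 1 ∷ _}           (1≤1 , 1≤hi , s) = 1≤1 , 1≤hi , parent-sorted s
  parent-sorted {w = suc (suc _) ∷ _} (_ , x≤hi , s)   =
    s≤s z≤n , ≤-trans (n≤1+n _) x≤hi , Sorted-weaken (n≤1+n _) s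

  parent-sum : ∀ {n} {w : Vec ℕ n} → Sorted 1 hi w → w ≢ ones n → suc (sum (parent w)) ≡ sum w
  parent-sum {w = []}              _           w≢1s = ⊥-elim (w≢1s refl)
  parent-sum {w = 1 ∷ _}           (_ , _ , s) w≢1s = cong suc (parent-sum s (w≢1s ∘ cong (1 ∷_)))
  parent-sum {w = suc (suc _) ∷ _} _           _    = refl

  parent-differ : ∀ {n} {w : Vec ℕ n} → Sorted 1 hi w → w ≢ ones n → DifferByOne n w (parent w)
  parent-differ {w = []}              _           w≢1s = ⊥-elim (w≢1s refl)
  parent-differ {w = 1 ∷ _}           (_ , _ , s) w≢1s = DifferByOne-∷ (parent-differ s (w≢1s ∘ cong (1 ∷_)))
  parent-differ {w = suc (suc x) ∷ _} _           _    = DifferByOne-head (inj₂ (+-comm (suc x) 1))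

  raiseLastOne-1∷ : ∀ {n} {w : Vec ℕ n} → Sorted 2 hi w → raiseLastOne (1 ∷ w) ≡ 2 ∷ w
  raiseLastOne-1∷ {w = []}              _               = refl
  raiseLastOne-1∷ {w = 1 ∷ _}           (s≤s () , _)
  raiseLastOne-1∷ {w = suc (suc _) ∷ _} _               = refl

  children : ∀ {n} {w : Vec ℕ n} → Sorted 1 hi w → w ≢ ones n →
             w ≡ raiseLastOne (parent w) ⊎ w ≡ raiseFirstNonOne (parent w)
  children {w = []}                        _           w≢1s = ⊥-elim (w≢1s refl)
  children {w = 1 ∷ []}                    _           w≢1s = ⊥-elim (w≢1s refl)
  children {w = 1 ∷ 1 ∷ _}                 (_ , _ , s) w≢1s =
    Sum.map (cong (1 ∷_)) (cong (1 ∷_)) (children s (w≢1s ∘ cong (1 ∷_)))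
  children {w = 1 ∷ 2 ∷ _}                 (_ , _ , _ , _ , s) _ =
    inj₁ (cong (1 ∷_) (sym (raiseLastOne-1∷ s)))
  children {w = 1 ∷ suc (suc (suc _)) ∷ _} _           _    = inj₂ refl
  children {w = 2 ∷ _}                     (_ , _ , s) _    = inj₁ (sym (raiseLastOne-1∷ s))
  children {w = suc (suc (suc _)) ∷ _}     _           _    = inj₂ refl

module SpanningTree (a d : ℕ) where

  _⇾_ : Rel (Vec ℕ a) 0ℓ
  u ⇾ v = Sorted 1 d u × u ≢ ones a × v ≡ parent u

  ⇾-functional : ∀ {u v w} → u ⇾ v → u ⇾ w → v ≡ w
  ⇾-functional (_ , _ , refl) (_ , _ , refl) = refl

  ⇾-decreasing : ∀ {u v} → u ⇾ v → sum v < sum u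
  ⇾-decreasing (s , u≢1s , refl) = ≤-reflexive (parent-sum s u≢1s)

  open ParentForest _⇾_ sum ⇾-functional ⇾-decreasing public

  root-or-parent : ∀ {v} → Sorted 1 d v → v ≡ ones a ⊎ ∃ λ u → v ⇾ u × Sorted 1 d u
  root-or-parent {v} s with ≡-dec _≟_ v (ones a)
  ... | yes v≡1s = inj₁ v≡1s
  ... | no  v≢1s = inj₂ (parent v , (s , v≢1s , refl) , parent-sorted s)

  adj-sym : ∀ {u v} → adj (G a d) u v → adj (G a d) v u
  adj-sym {u} {v} (u∈S , v∈S , u~v) = v∈S , u∈S , DifferByOne-sym {u = u} {v} u~v

  ⇾⊆adj : ∀ {u v} → u ⇾ v → adj (G a d) u v
  ⇾⊆adj (s , u≢1s , refl) = Sorted⇒InS s , Sorted⇒InS (parent-sorted s) , parent-differ s u≢1s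

  Edge⊆adj : ∀ {u v} → Edge u v → adj (G a d) u v
  Edge⊆adj (inj₁ u⇾v) = ⇾⊆adj u⇾v
  Edge⊆adj {u} {v} (inj₂ v⇾u) = adj-sym {v} {u} (⇾⊆adj v⇾u)

  isSpanningTree : IsSpanningTree (G a d) Edge
  isSpanningTree = record
    { subgraph  = λ _ _ → Edge⊆adj
    ; symmetric = λ _ _ → Edge-sym
    ; connected = λ _ _ u∈S v∈S → connected root-or-parent (InS⇒Sorted u∈S) (InS⇒Sorted v∈S)
    ; acyclic   = acyclic
    }

  maxDegree≤3 : MaxDegree≤ (G a d) Edge 3
  maxDegree≤3 v _ = parent v ∷ raiseLastOne v ∷ raiseFirstNonOne v ∷ [] , ≤-refl , neighbour
    where
    neighbour : ∀ w → Edge v w → w ∈ parent v ∷ raiseLastOne v ∷ raiseFirstNonOne v ∷ []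
    neighbour w (inj₁ (_ , _ , w≡parent)) = here w≡parent
    neighbour w (inj₂ (s , w≢1s , refl)) with children s w≢1s
    ... | inj₁ w≡child = there (here w≡child)
    ... | inj₂ w≡child = there (there (here w≡child))

-- The construction works for every a and d.
lemma2 : (a d : ℕ) → 1 ≤ a → 1 ≤ d →
    Σ (Rel (Vec ℕ a) 0ℓ) λ T → IsSpanningTree (G a d) T × MaxDegree≤ (G a d) T 3
lemma2 a d _ _ = Edge , isSpanningTree , maxDegree≤3
  where open SpanningTree a d
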